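{- For all integers $r,n\ge 1$, $$ r\,n^{1/r} \;\ge\; |P(n,?,1,r)| \;\ge\; r\,n^{1/r}-2r+1 .$$
   Context: Search model $P(n,?,d,r)$: an unknown set $E\subseteq [n]=\{1,\dots,n\}$ (possibly empty) of "excellent" elements is fixed. A Questioner proceeds in $r$ rounds; in round $t$ ($1\le t\le r$) he poses a finite family of queries, i.e. subsets $A\subseteq[n]$, chosen depending only on the answers received in rounds $1,\dots,t-1$ (queries within one round are posed simultaneously). The answer to a query $A$ is "yes" if $A\cap E\neq\emptyset$ and "no" otherwise. After round $r$ the Questioner must either name $d$ distinct elements that are guaranteed to be excellent, or correctly state that there are at most $d-1$ excellent elements; the output must be correct for every set $E$ consistent with all the answers received. $|P(n,?,d,r)|$ denotes the complexity of this problem: the minimum, over all such $r$-round strategies, of the maximum over all $E\subseteq[n]$ of the total number of queries asked. For $d=1$ the goal is to find one excellent element or state that there is none. -}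

module Defs where

open import Data.Nat using (ℕ; zero; suc; _+_; _≤_)
open import Data.Bool using (Bool; true; false; _∧_; _∨_)
open import Data.Fin using (Fin)
open import Data.Vec using (Vec; []; _∷_; map; lookup)
open import Data.Product using (Σ-syntax; _×_)
open import Relation.Binary.PropositionalEquality using (_≡_)

-- Elements of [n] are Fin n; a subset of [n] (a query A, or the set E of
-- excellent elements) is a characteristic vector  Vec Bool n.
Subset : ℕ → Set
Subset n = Vec Bool n

answer : ∀ {n} → Subset n → Subset n → Bool
answer []      []      = false
answer (a ∷ A) (e ∷ E) = (a ∧ e) ∨ answer A E

-- Final output for d = 1: name one element claimed excellent, or state that
-- there is no excellent element (at most d - 1 = 0 of them).
data Output (n : ℕ) : Set where
  name   : Fin n → Output n
  noneEx : Output n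

-- In each round a finite family of k queries
-- (a Vec of subsets) is posed simultaneously; what happens afterwards depends
-- on the vector of the k answers (and, via nesting, on all earlier answers).
data Strategy (n : ℕ) : ℕ → Set where
  finish : Output n → Strategy n zero
  round  : ∀ {r} (k : ℕ) → Vec (Subset n) k →
           (Vec Bool k → Strategy n r) → Strategy n (suc r)

output : ∀ {n r} → Strategy n r → Subset n → Output n
output (finish o)     E = o
output (round k qs f) E = output (f (map (λ A → answer A E) qs)) E

cost : ∀ {n r} → Strategy n r → Subset n → ℕ
cost (finish o)     E = zero
cost (round k qs f) E = k + cost (f (map (λ A → answer A E) qs)) E

CorrectFor : ∀ {n} → Subset n → Output n → Set
CorrectFor E (name i) = lookup E i ≡ true
CorrectFor E noneEx   = ∀ i → lookup E i ≡ false

-- the strategy solves P(n,?,1,r): its output is correct for every E.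
-- (The output is a function of the answers only, so this is the same as
-- being correct for every E consistent with the answers received.)
Solves : ∀ {n r} → Strategy n r → Set
Solves {n} S = ∀ (E : Subset n) → CorrectFor E (output S E)

WorstCost≤ : ∀ {n r} → Strategy n r → ℕ → Set
WorstCost≤ {n} S q = ∀ (E : Subset n) → cost S E ≤ q

-- |P(n,?,1,r)| ≤ q  iff some correct r-round strategy uses ≤ q queries always
Achievable : ℕ → ℕ → ℕ → Set
Achievable n r q = Σ[ S ∈ Strategy n r ] (Solves S × WorstCost≤ S q)

-- Let m = ⌊n^{1/r}⌋, so n < (m+1)^r. The questioner locates the least excellent
-- element digit by digit in base m+1: with lo the current lower end and w = (m+1)^j, one round
-- asks "is some element below lo + d·w excellent?" for d = 1, …, m and moves lo to the last
-- threshold answered no. That is r·m queries, and (r·m)^r = r^r m^r ≤ r^r n.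
--
-- An adversary keeps a candidate set C for the excellent elements. In a round of
-- k queries it answers no to every query that meets C in at most M elements, deleting those
-- elements from C, and yes to the others, which keep more than M candidates each. With
-- capacity 0 b = 1 and capacity (j+1) b = max_{k ≤ b} (k+1)·capacity j (b ∸ k), a budget of b
-- queries in j rounds is defeated as soon as C has capacity j b elements. Weighted AM-GM gives
-- j^j · capacity j b ≤ (b+j)^j, so a strategy with q queries needs r^r n ≤ (q+r)^r.

module Submission where

open import Defs
open import Data.Nat
  using (ℕ; zero; suc; _+_; _*_; _∸_; _^_; _≤_; _<_; _<ᵇ_; _≤?_; _<?_; z≤n; s≤s; s≤s⁻¹; NonZero)
open import Data.Nat.Properties
open import Data.Nat.Tactic.RingSolver using (solve-∀)
open import Data.Bool using (Bool; true; false)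
open import Data.Bool.Properties using (¬-not; T-≡)
open import Data.Fin using (Fin; zero; suc; toℕ; fromℕ<)
open import Data.Fin.Properties using (any?; toℕ-injective; toℕ-fromℕ<; toℕ<n) renaming (_≟_ to _≟ᶠ_)
open import Data.Fin.Subset using (_∈_; _∉_; _⊆_; _∩_; _─_; _-_; ⁅_⁆; ∣_∣; Nonempty) renaming (⊤ to ⊤ˢ)
open import Data.Fin.Subset.Properties
  using (_∈?_; nonempty?; Empty-unique; ∣⊥∣≡0; ∣⊤∣≡n; ∈⊤; x∈⁅x⁆; ∣⁅x⁆∣≡1; x∈p⇒∣p-x∣<∣p∣; x∈p∩q⁺; x∈p∩q⁻;
         x∈p∧x≢y⇒x∈p-y; p─q⊆p; p⊆q⇒∣p∣≤∣q∣; ∣p∩q∣≤∣p∣; ⊆-refl; ⊆-trans; ∩-identityˡ)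
open import Data.List using (upTo)
open import Data.List.Extrema.Nat using (argmax; argmax-all; f[xs]≤f[argmax])
open import Data.List.Membership.Propositional.Properties using (∈-upTo⁺; ∈-upTo⁻)
import Data.List.Relation.Unary.All as All
open import Data.Vec using (Vec; []; _∷_; map; lookup; tabulate; here; there)
open import Data.Vec.Properties using ([]=⇒lookup; lookup⇒[]=; lookup-map; lookup∘tabulate)
open import Data.Vec.Relation.Binary.Pointwise.Extensional using (ext; Pointwise-≡⇒≡)
open import Data.Product using (Σ-syntax; ∃-syntax; _×_; _,_)
import Data.Product as Product
open import Data.Sum using (_⊎_; inj₁; inj₂; [_,_])
import Data.Sum as Sum
open import Data.Empty using (⊥)
open import Function using (_∘_; Equivalence)
open import Relation.Nullary using (Dec; ¬_; yes; no; contradiction)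
open import Relation.Nullary.Decidable using (_×-dec_)
open import Relation.Binary.PropositionalEquality
  using (_≡_; refl; sym; trans; cong; cong₂; subst; subst₂; module ≡-Reasoning)

rearrangement : ∀ {a b c d} → a ≤ b → c ≤ d → a * d + b * c ≤ a * c + b * d
rearrangement {a} {_} {c} a≤b c≤d with e , refl ← m≤n⇒∃[o]m+o≡n a≤b | f , refl ← m≤n⇒∃[o]m+o≡n c≤d =
  subst (a * (c + f) + (a + e) * c ≤_) (expand a c e f) (m≤m+n _ (e * f))
  where
  expand : ∀ a c e f → a * (c + f) + (a + e) * c + e * f ≡ a * c + (a + e) * (c + f)
  expand = solve-∀

pow-rearrangement : ∀ k x y → x * y ^ k + y * x ^ k ≤ x ^ suc k + y ^ suc k
pow-rearrangement k x y with ≤-total x y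
... | inj₁ x≤y = rearrangement x≤y (^-monoˡ-≤ k x≤y)
... | inj₂ y≤x =
  subst₂ _≤_ (+-comm (y * x ^ k) _) (+-comm (y * y ^ k) _) (rearrangement y≤x (^-monoˡ-≤ k y≤x))

am-gm : ∀ j x y → suc j * (x * y ^ j) ≤ x ^ suc j + j * y ^ suc j
am-gm zero    x y = ≤-refl
am-gm (suc j) x y = begin
  suc (suc j) * (x * y ^ suc j)                            ≡⟨ peel j x y (y ^ j) ⟩
  suc j * (x * y ^ j) * y + x * y ^ suc j                  ≤⟨ +-monoˡ-≤ _ (*-monoˡ-≤ y (am-gm j x y)) ⟩
  (x ^ suc j + j * y ^ suc j) * y + x * y ^ suc j          ≡⟨ regroup j x y (x ^ suc j) (y ^ j) ⟩
  (x * y ^ suc j + y * x ^ suc j) + j * y ^ suc (suc j)    ≤⟨ +-monoˡ-≤ _ (pow-rearrangement (suc j) x y) ⟩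
  x ^ suc (suc j) + y ^ suc (suc j) + j * y ^ suc (suc j)  ≡⟨ +-assoc (x ^ suc (suc j)) _ _ ⟩
  x ^ suc (suc j) + suc j * y ^ suc (suc j)                ∎
  where
  open ≤-Reasoning
  peel : ∀ j x y Y → suc (suc j) * (x * (y * Y)) ≡ suc j * (x * Y) * y + x * (y * Y)
  peel = solve-∀
  regroup : ∀ j x y X Y → (X + j * (y * Y)) * y + x * (y * Y) ≡ (x * (y * Y) + y * X) + j * (y * (y * Y))
  regroup = solve-∀

^-distribʳ-* : ∀ m n o → (m * n) ^ o ≡ m ^ o * n ^ o
^-distribʳ-* m n zero    = refl
^-distribʳ-* m n (suc o) = begin
  m * n * (m * n) ^ o     ≡⟨ cong (m * n *_) (^-distribʳ-* m n o) ⟩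
  m * n * (m ^ o * n ^ o) ≡⟨ swap m n (m ^ o) (n ^ o) ⟩
  m * m ^ o * (n * n ^ o) ∎
  where
  open ≡-Reasoning
  swap : ∀ m n M N → m * n * (M * N) ≡ m * M * (n * N)
  swap = solve-∀

weighted-am-gm : ∀ j x y → suc j ^ suc j * x * y ^ j ≤ j ^ j * (x + y) ^ suc j
weighted-am-gm zero    x y = subst₂ _≤_ (unitˡ x) (unitʳ (x + y)) (m≤m+n x y)
  where
  unitˡ : ∀ z → z ≡ 1 * z * 1
  unitˡ = solve-∀
  unitʳ : ∀ z → z ≡ 1 * (z * 1)
  unitʳ = solve-∀
weighted-am-gm (suc i) x y = *-cancelˡ-≤ j (+-cancelʳ-≤ common _ _ (begin
  j * (suc j ^ suc j * x * y ^ j) + common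
    ≡⟨ spread j x y (suc j ^ j) (y ^ j) ⟩
  suc j * (j * (x + y) * (suc j ^ j * y ^ j))
    ≡⟨ cong (λ z → suc j * (j * (x + y) * z)) (sym (^-distribʳ-* (suc j) y j)) ⟩
  suc j * (j * (x + y) * (suc j * y) ^ j)
    ≤⟨ am-gm j (j * (x + y)) (suc j * y) ⟩
  (j * (x + y)) ^ suc j + j * (suc j * y) ^ suc j
    ≡⟨ cong₂ (λ u v → j * (x + y) * u + j * (suc j * y * v))
             (^-distribʳ-* j (x + y) j) (^-distribʳ-* (suc j) y j) ⟩
  j * (x + y) * (j ^ j * (x + y) ^ j) + j * (suc j * y * (suc j ^ j * y ^ j))
    ≡⟨ collect j (x + y) y (j ^ j) ((x + y) ^ j) (suc j ^ j) (y ^ j) ⟩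
  j * (j ^ j * (x + y) ^ suc j) + common ∎))
  where
  open ≤-Reasoning
  j = suc i
  common = j * (suc j ^ suc j * y ^ suc j)
  spread : ∀ j x y B Y →
           j * (suc j * B * x * Y) + j * (suc j * B * (y * Y)) ≡ suc j * (j * (x + y) * (B * Y))
  spread = solve-∀
  collect : ∀ j s y J S B Y →
            j * s * (J * S) + j * (suc j * y * (B * Y)) ≡ j * (J * (s * S)) + j * (suc j * B * (y * Y))
  collect = solve-∀

-- The adversary's capacity

-- capacityAfter j b k: candidates the adversary needs when the first of j + 1 rounds asks k of
-- the b queries; each query answered no deletes at most capacity j (b ∸ k) of them, and that
-- many must remain for the later rounds.
capacity      : ℕ → ℕ → ℕ
capacityAfter : ℕ → ℕ → ℕ → ℕ

capacity zero    b = 1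
capacity (suc j) b = capacityAfter j b (argmax (capacityAfter j b) 0 (upTo (suc b)))

capacityAfter j b k = suc k * capacity j (b ∸ k)

capacityAfter≤capacity : ∀ j {b k} → k ≤ b → capacityAfter j b k ≤ capacity (suc j) b
capacityAfter≤capacity j {b} k≤b =
  All.lookup (f[xs]≤f[argmax] {f = capacityAfter j b} 0 (upTo (suc b))) (∈-upTo⁺ (s≤s k≤b))

argmax-capacityAfter≤ : ∀ j b → argmax (capacityAfter j b) 0 (upTo (suc b)) ≤ b
argmax-capacityAfter≤ j b = argmax-all (capacityAfter j b) z≤n (All.tabulate (s≤s⁻¹ ∘ ∈-upTo⁻))

n^n≢0 : ∀ n → NonZero (n ^ n)
n^n≢0 zero    = _
n^n≢0 (suc n) = m^n≢0 (suc n) (suc n)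

capacity-bound : ∀ j b → j ^ j * capacity j b ≤ (b + j) ^ j
capacity-bound zero    b = ≤-refl
capacity-bound (suc j) b = *-cancelˡ-≤ (j ^ j) {{n^n≢0 j}} (begin
  j ^ j * (suc j ^ suc j * (suc k * c)) ≡⟨ reorder (j ^ j) (suc j ^ suc j) (suc k) c ⟩
  suc j ^ suc j * suc k * (j ^ j * c)   ≤⟨ *-monoʳ-≤ (suc j ^ suc j * suc k) (capacity-bound j (b ∸ k)) ⟩
  suc j ^ suc j * suc k * (b ∸ k + j) ^ j ≤⟨ weighted-am-gm j (suc k) (b ∸ k + j) ⟩
  j ^ j * (suc k + (b ∸ k + j)) ^ suc j ≡⟨ cong (λ z → j ^ j * z ^ suc j) sum≡ ⟩
  j ^ j * (b + suc j) ^ suc j ∎)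
  where
  open ≤-Reasoning
  k = argmax (capacityAfter j b) 0 (upTo (suc b))
  c = capacity j (b ∸ k)
  reorder : ∀ a x y z → a * (x * (y * z)) ≡ x * y * (a * z)
  reorder = solve-∀
  sum≡ : suc k + (b ∸ k + j) ≡ b + suc j
  sum≡ = begin-equality
    suc (k + (b ∸ k + j)) ≡⟨ cong suc (sym (+-assoc k (b ∸ k) j)) ⟩
    suc (k + (b ∸ k) + j) ≡⟨ cong (λ z → suc (z + j)) (m+[n∸m]≡n (argmax-capacityAfter≤ j b)) ⟩
    suc (b + j)           ≡⟨ sym (+-suc b j) ⟩
    b + suc j             ∎

answer≡true⇒Nonempty : ∀ {n} (A E : Subset n) → answer A E ≡ true → Nonempty (A ∩ E)
answer≡true⇒Nonempty []          []          ()
answer≡true⇒Nonempty (true  ∷ A) (true  ∷ E) _ = zero , here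
answer≡true⇒Nonempty (true  ∷ A) (false ∷ E) p = Product.map suc there (answer≡true⇒Nonempty A E p)
answer≡true⇒Nonempty (false ∷ A) (_     ∷ E) p = Product.map suc there (answer≡true⇒Nonempty A E p)

Nonempty⇒answer≡true : ∀ {n} (A E : Subset n) → Nonempty (A ∩ E) → answer A E ≡ true
Nonempty⇒answer≡true (true  ∷ A) (true  ∷ E) _                 = refl
Nonempty⇒answer≡true (true  ∷ A) (false ∷ E) (suc i , there p) = Nonempty⇒answer≡true A E (i , p)
Nonempty⇒answer≡true (false ∷ A) (_     ∷ E) (suc i , there p) = Nonempty⇒answer≡true A E (i , p)

Nonempty⇒∣p∣>0 : ∀ {n} {p : Subset n} → Nonempty p → 0 < ∣ p ∣
Nonempty⇒∣p∣>0 (_ , x∈p) = ≤-<-trans z≤n (x∈p⇒∣p-x∣<∣p∣ x∈p)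

∣p∣>0⇒Nonempty : ∀ {n} {p : Subset n} → 0 < ∣ p ∣ → Nonempty p
∣p∣>0⇒Nonempty {n} {p} ∣p∣>0 with nonempty? p
... | yes nonempty = nonempty
... | no  empty    = contradiction (trans (cong ∣_∣ (Empty-unique empty)) (∣⊥∣≡0 n)) (>⇒≢ ∣p∣>0)

Disjoint : ∀ {n} → Subset n → Subset n → Set
Disjoint A C = ∣ A ∩ C ∣ ≡ 0

∩-monoʳ-⊆ : ∀ {n} (p : Subset n) {q r} → q ⊆ r → p ∩ q ⊆ p ∩ r
∩-monoʳ-⊆ p q⊆r x∈p∩q with x∈p , x∈q ← x∈p∩q⁻ p _ x∈p∩q = x∈p∩q⁺ (x∈p , q⊆r x∈q)

Disjoint-⊆ : ∀ {n} (A : Subset n) {C D} → D ⊆ C → Disjoint A C → Disjoint A D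
Disjoint-⊆ A D⊆C A∩C≡0 = n≤0⇒n≡0 (subst (_ ≤_) A∩C≡0 (p⊆q⇒∣p∣≤∣q∣ (∩-monoʳ-⊆ A D⊆C)))

Disjoint-─ : ∀ {n} (A C : Subset n) → Disjoint A (C ─ A)
Disjoint-─ []          []          = refl
Disjoint-─ (false ∷ A) (_     ∷ C) = Disjoint-─ A C
Disjoint-─ (true  ∷ A) (false ∷ C) = Disjoint-─ A C
Disjoint-─ (true  ∷ A) (true  ∷ C) = Disjoint-─ A C

x∉p-x : ∀ {n} (p : Subset n) x → x ∉ p - x
x∉p-x p x x∈p-x = >⇒≢ (Nonempty⇒∣p∣>0 (x , x∈p∩q⁺ (x∈⁅x⁆ x , x∈p-x))) (Disjoint-─ ⁅ x ⁆ p)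

∣p∩q∣>0⇒answer≡true : ∀ {n} (A E : Subset n) → 0 < ∣ A ∩ E ∣ → answer A E ≡ true
∣p∩q∣>0⇒answer≡true A E = Nonempty⇒answer≡true A E ∘ ∣p∣>0⇒Nonempty

Disjoint⇒answer≡false : ∀ {n} (A E : Subset n) → Disjoint A E → answer A E ≡ false
Disjoint⇒answer≡false A E A∩E≡0 with answer A E in eq
... | false = refl
... | true  = contradiction A∩E≡0 (>⇒≢ (Nonempty⇒∣p∣>0 (answer≡true⇒Nonempty A E eq)))

∣p∩q∣≤∣p∩[q─r]∣+∣r∩q∣ : ∀ {n} (p q r : Subset n) → ∣ p ∩ q ∣ ≤ ∣ p ∩ (q ─ r) ∣ + ∣ r ∩ q ∣
∣p∩q∣≤∣p∩[q─r]∣+∣r∩q∣ []          []          []          = z≤n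
∣p∩q∣≤∣p∩[q─r]∣+∣r∩q∣ (false ∷ p) (false ∷ q) (false ∷ r) = ∣p∩q∣≤∣p∩[q─r]∣+∣r∩q∣ p q r
∣p∩q∣≤∣p∩[q─r]∣+∣r∩q∣ (false ∷ p) (false ∷ q) (true  ∷ r) = ∣p∩q∣≤∣p∩[q─r]∣+∣r∩q∣ p q r
∣p∩q∣≤∣p∩[q─r]∣+∣r∩q∣ (true  ∷ p) (false ∷ q) (false ∷ r) = ∣p∩q∣≤∣p∩[q─r]∣+∣r∩q∣ p q r
∣p∩q∣≤∣p∩[q─r]∣+∣r∩q∣ (true  ∷ p) (false ∷ q) (true  ∷ r) = ∣p∩q∣≤∣p∩[q─r]∣+∣r∩q∣ p q r
∣p∩q∣≤∣p∩[q─r]∣+∣r∩q∣ (false ∷ p) (true  ∷ q) (false ∷ r) = ∣p∩q∣≤∣p∩[q─r]∣+∣r∩q∣ p q r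
∣p∩q∣≤∣p∩[q─r]∣+∣r∩q∣ (false ∷ p) (true  ∷ q) (true  ∷ r) =
  ≤-trans (∣p∩q∣≤∣p∩[q─r]∣+∣r∩q∣ p q r) (+-monoʳ-≤ _ (n≤1+n _))
∣p∩q∣≤∣p∩[q─r]∣+∣r∩q∣ (true  ∷ p) (true  ∷ q) (false ∷ r) = s≤s (∣p∩q∣≤∣p∩[q─r]∣+∣r∩q∣ p q r)
∣p∩q∣≤∣p∩[q─r]∣+∣r∩q∣ (true  ∷ p) (true  ∷ q) (true  ∷ r) =
  ≤-trans (s≤s (∣p∩q∣≤∣p∩[q─r]∣+∣r∩q∣ p q r)) (≤-reflexive (sym (+-suc _ _)))

record Shrinking {n} (s : ℕ) (C C′ : Subset n) : Set where
  field
    subset : C′ ⊆ C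
    loss    : ∀ X → ∣ X ∩ C ∣ ≤ ∣ X ∩ C′ ∣ + s

  survivors : ∀ {m} X → m + s ≤ ∣ X ∩ C ∣ → m ≤ ∣ X ∩ C′ ∣
  survivors {m} X m+s≤ = +-cancelʳ-≤ s m _ (≤-trans m+s≤ (loss X))

  total-survivors : ∀ {m} → m + s ≤ ∣ C ∣ → m ≤ ∣ C′ ∣
  total-survivors m+s≤ = subst (_ ≤_) (cong ∣_∣ (∩-identityˡ C′))
    (survivors ⊤ˢ (subst (_ ≤_) (sym (cong ∣_∣ (∩-identityˡ C))) m+s≤))

open Shrinking using (subset; loss)

shrinking-refl : ∀ {n} {C : Subset n} → Shrinking 0 C C
shrinking-refl = record { subset = ⊆-refl ; loss = λ X → m≤m+n _ 0 }

shrinking-trans : ∀ {n s t} {C D F : Subset n} → Shrinking s C D → Shrinking t D F → Shrinking (s + t) C F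
shrinking-trans {s = s} {t} {C} {D} {F} C⇝D D⇝F = record
  { subset = ⊆-trans (subset D⇝F) (subset C⇝D)
  ; loss    = λ X → begin
      ∣ X ∩ C ∣         ≤⟨ loss C⇝D X ⟩
      ∣ X ∩ D ∣ + s     ≤⟨ +-monoˡ-≤ s (loss D⇝F X) ⟩
      ∣ X ∩ F ∣ + t + s ≡⟨ +-assoc _ t s ⟩
      ∣ X ∩ F ∣ + (t + s) ≡⟨ cong (∣ X ∩ F ∣ +_) (+-comm t s) ⟩
      ∣ X ∩ F ∣ + (s + t) ∎
  }
  where open ≤-Reasoning

shrinking-mono : ∀ {n s t} {C D : Subset n} → s ≤ t → Shrinking s C D → Shrinking t C D
shrinking-mono s≤t C⇝D = record
  { subset = subset C⇝D ; loss = λ X → ≤-trans (loss C⇝D X) (+-monoʳ-≤ _ s≤t) }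

─-shrinking : ∀ {n} (C A : Subset n) → Shrinking ∣ A ∩ C ∣ C (C ─ A)
─-shrinking C A = record { subset = p─q⊆p C A ; loss = λ X → ∣p∩q∣≤∣p∩[q─r]∣+∣r∩q∣ X C A }

-- The adversary

record Reply {n k} (qs : Vec (Subset n) k) (M s : ℕ) (C : Subset n) : Set where
  field
    C′                : Subset n
    accepted          : Subset k
    shrinking         : Shrinking s C C′
    rejected-disjoint : ∀ {i} → i ∉ accepted → Disjoint (lookup qs i) C′
    accepted-large    : ∀ {i} → i ∈ accepted → M < ∣ lookup qs i ∩ C′ ∣

-- Greedy: answer no to a live query meeting C in at most M elements and delete those from C.
-- The deletion can make other live queries small, hence the loop, at most t times.
reply-among : ∀ {n k} (qs : Vec (Subset n) k) M t (C : Subset n) (live : Subset k) → ∣ live ∣ ≤ t →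
        (∀ {i} → i ∉ live → Disjoint (lookup qs i) C) → Reply qs M (t * M) C
reply-among qs M zero C live ∣live∣≤0 dead = record
  { C′ = C ; accepted = live ; shrinking = shrinking-refl ; rejected-disjoint = dead
  ; accepted-large = λ i∈live → contradiction ∣live∣≤0 (<⇒≱ (Nonempty⇒∣p∣>0 (_ , i∈live))) }
reply-among qs M (suc t) C live ∣live∣≤t dead with any? (λ i → i ∈? live ×-dec ∣ lookup qs i ∩ C ∣ ≤? M)
... | no none-small = record
  { C′ = C ; accepted = live ; shrinking = shrinking-mono z≤n shrinking-refl ; rejected-disjoint = dead
  ; accepted-large = λ i∈live → ≰⇒> (λ small → none-small (_ , i∈live , small)) }
... | yes (i , i∈live , small) = record
  { C′ = C′ ; accepted = accepted ; rejected-disjoint = rejected-disjoint ; accepted-large = accepted-large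
  ; shrinking = shrinking-mono (+-monoˡ-≤ (t * M) small) (shrinking-trans (─-shrinking C A) shrinking) }
  where
  A = lookup qs i
  dead′ : ∀ {j} → j ∉ live - i → Disjoint (lookup qs j) (C ─ A)
  dead′ {j} j∉ with j ≟ᶠ i
  ... | yes refl = Disjoint-─ A C
  ... | no  j≢i  = Disjoint-⊆ (lookup qs j) (p─q⊆p C A) (dead (λ j∈live → j∉ (x∈p∧x≢y⇒x∈p-y j∈live j≢i)))
  open Reply (reply-among qs M t (C ─ A) (live - i)
    (s≤s⁻¹ (<-≤-trans (x∈p⇒∣p-x∣<∣p∣ i∈live) ∣live∣≤t)) dead′)

reply : ∀ {n k} (qs : Vec (Subset n) k) M (C : Subset n) → Reply qs M (k * M) C
reply {k = k} qs M C = reply-among qs M k C ⊤ˢ (≤-reflexive (∣⊤∣≡n k)) (λ i∉⊤ → contradiction ∈⊤ i∉⊤)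

reply-answers : ∀ {n k} {qs : Vec (Subset n) k} {M s C} (R : Reply qs M s C) {E : Subset n} →
                E ⊆ Reply.C′ R → (∀ {i} → i ∈ Reply.accepted R → answer (lookup qs i) E ≡ true) →
                map (λ A → answer A E) qs ≡ Reply.accepted R
reply-answers {qs = qs} R {E} E⊆C′ yes-on-accepted =
  Pointwise-≡⇒≡ (ext λ i → trans (lookup-map i _ qs) (agrees i))
  where
  open Reply R
  agrees : ∀ i → answer (lookup qs i) E ≡ lookup accepted i
  agrees i with lookup accepted i in eq
  ... | true  = yes-on-accepted (lookup⇒[]= i accepted eq)
  ... | false = Disjoint⇒answer≡false (lookup qs i) E (Disjoint-⊆ (lookup qs i) E⊆C′ (rejected-disjoint i∉))
    where
    i∉ : i ∉ accepted
    i∉ i∈ = contradiction (trans (sym ([]=⇒lookup i∈)) eq) λ ()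

-- Yes holds the queries answered yes so far; E must still meet them to be consistent.
record Counterexample {n j} (S : Strategy n j) (b : ℕ) (C : Subset n) (Yes : Subset n → Set) : Set where
  field
    E         : Subset n
    E⊆C       : E ⊆ C
    keeps-yes : ∀ {A} → Yes A → answer A E ≡ true
    defeats   : ¬ CorrectFor E (output S E) ⊎ b < cost S E

adversary : ∀ {n} j (S : Strategy n j) b (C : Subset n) (Yes : Subset n → Set) →
            capacity j b ≤ ∣ C ∣ → (∀ {A} → Yes A → capacity j b < ∣ A ∩ C ∣) →
            Counterexample S b C Yes
adversary zero (finish noneEx) b C Yes C≢∅ Yes-large = record
  { E = C ; E⊆C = ⊆-refl
  ; keeps-yes = λ {A} y → ∣p∩q∣>0⇒answer≡true A C (≤-trans (s≤s z≤n) (Yes-large y))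
  ; defeats = inj₁ λ none → let i , i∈C = ∣p∣>0⇒Nonempty {p = C} C≢∅ in
      contradiction (trans (sym ([]=⇒lookup i∈C)) (none i)) λ () }
adversary zero (finish (name x)) b C Yes _ Yes-large = record
  { E = C - x ; E⊆C = p─q⊆p C ⁅ x ⁆
  ; keeps-yes = λ {A} y → ∣p∩q∣>0⇒answer≡true A (C - x) (Shrinking.survivors x-removed A (Yes-large y))
  ; defeats = inj₁ λ x∈E → x∉p-x C x (lookup⇒[]= x (C - x) x∈E) }
  where
  x-removed : Shrinking 1 C (C - x)
  x-removed = shrinking-mono (≤-trans (∣p∩q∣≤∣p∣ ⁅ x ⁆ C) (≤-reflexive (∣⁅x⁆∣≡1 x))) (─-shrinking C ⁅ x ⁆)
-- A with-abstraction (or rewrite) in this clause makes Agda normalise capacity (suc j) b,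
-- which is very slow; hence the helper matching on the decision, and subst below.
adversary (suc j) (round k qs f) b C Yes C-large Yes-large = by-budget (b <? k)
  where
  by-budget : Dec (b < k) → Counterexample (round k qs f) b C Yes
  by-budget (yes b<k) = record
    { E = C ; E⊆C = ⊆-refl
    ; keeps-yes = λ {A} y → ∣p∩q∣>0⇒answer≡true A C (≤-trans (s≤s z≤n) (Yes-large y))
    ; defeats = inj₂ (<-≤-trans b<k (m≤m+n k _)) }
  by-budget (no b≮k) = record
    { E = E ; E⊆C = ⊆-trans E⊆C′ (subset shrinking)
    ; keeps-yes = keeps-yes ∘ inj₁ ; defeats = defeats-round }
    where
    k≤b = ≮⇒≥ b≮k
    M = capacity j (b ∸ k)
    budget : M + k * M ≤ capacity (suc j) b
    budget = capacityAfter≤capacity j k≤b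
    R = reply qs M C
    open Reply R
    open Shrinking shrinking using (survivors; total-survivors)
    Yes′ : Subset _ → Set
    Yes′ A = Yes A ⊎ ∃[ i ] i ∈ accepted × lookup qs i ≡ A
    Yes′-large : ∀ {A} → Yes′ A → M < ∣ A ∩ C′ ∣
    Yes′-large {A} (inj₁ y)            = survivors A (≤-trans (s≤s budget) (Yes-large y))
    Yes′-large (inj₂ (i , i∈ , refl)) = accepted-large i∈
    open Counterexample
      (adversary j (f accepted) (b ∸ k) C′ Yes′ (total-survivors (≤-trans budget C-large)) Yes′-large)
      renaming (E⊆C to E⊆C′)
    defeats-round : ¬ CorrectFor E (output (round k qs f) E) ⊎ b < cost (round k qs f) E
    defeats-round = subst (λ as → ¬ CorrectFor E (output (f as) E) ⊎ b < k + cost (f as) E)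
      (sym (reply-answers R E⊆C′ (λ i∈ → keeps-yes (inj₂ (_ , i∈ , refl)))))
      (Sum.map₂ (λ over → subst (_< k + cost (f accepted) E) (m+[n∸m]≡n k≤b) (+-monoʳ-< k over)) defeats)

capacity≤n⇒¬achievable : ∀ {n r q} → capacity r q ≤ n → ¬ Achievable n r q
capacity≤n⇒¬achievable {n} {r} {q} c≤n (S , solves , within) =
  [ (λ wrong → wrong (solves E)) , (λ over → <⇒≱ over (within E)) ] defeats
  where open Counterexample
          (adversary r S q ⊤ˢ (λ _ → ⊥) (subst (capacity r q ≤_) (sym (∣⊤∣≡n n)) c≤n) λ ())

lower-bound : ∀ {n r q} → 1 ≤ r → Achievable n r q → r ^ r * n ≤ (q + 2 * r ∸ 1) ^ r
lower-bound {n} {r} {q} r≥1 achievable = begin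
  r ^ r * n            ≤⟨ *-monoʳ-≤ (r ^ r) (<⇒≤ (≰⇒> λ c≤n → capacity≤n⇒¬achievable c≤n achievable)) ⟩
  r ^ r * capacity r q ≤⟨ capacity-bound r q ⟩
  (q + r) ^ r          ≤⟨ ^-monoˡ-≤ r (m+n≤o⇒m≤o∸n (q + r) q+r+1≤q+2r) ⟩
  (q + 2 * r ∸ 1) ^ r  ∎
  where
  open ≤-Reasoning
  q+r+1≤q+2r : q + r + 1 ≤ q + 2 * r
  q+r+1≤q+2r = begin
    q + r + 1       ≡⟨ +-assoc q r 1 ⟩
    q + (r + 1)     ≤⟨ +-monoʳ-≤ q (+-monoʳ-≤ r r≥1) ⟩
    q + (r + r)     ≡⟨ cong (λ z → q + (r + z)) (sym (+-identityʳ r)) ⟩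
    q + 2 * r       ∎

-- The search strategy

nth-root : ∀ {r} → 1 ≤ r → ∀ n → ∃[ m ] m ^ r ≤ n × n < suc m ^ r
nth-root {suc r} _   zero    = 0 , z≤n , m^n>0 1 (suc r)
nth-root {suc r} r≥1 (suc n) with nth-root r≥1 n
... | m , mʳ≤n , n<[1+m]ʳ with suc m ^ suc r ≤? suc n
...   | yes [1+m]ʳ≤1+n = suc m , [1+m]ʳ≤1+n , <-≤-trans (s≤s n<[1+m]ʳ) (^-monoˡ-< (suc r) (n<1+n (suc m)))
...   | no  [1+m]ʳ≰1+n = m , m≤n⇒m≤1+n mʳ≤n , ≰⇒> [1+m]ʳ≰1+n

below : ∀ {n} → ℕ → Subset n
below x = tabulate (λ i → toℕ i <ᵇ x)

∈-below⁺ : ∀ {n} {i : Fin n} {x} → toℕ i < x → i ∈ below x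
∈-below⁺ {i = i} {x} i<x =
  lookup⇒[]= i (below x) (trans (lookup∘tabulate _ i) (Equivalence.to T-≡ (<⇒<ᵇ i<x)))

∈-below⁻ : ∀ {n} {i : Fin n} {x} → i ∈ below x → toℕ i < x
∈-below⁻ {i = i} {x} i∈ =
  <ᵇ⇒< (toℕ i) x (Equivalence.from T-≡ (trans (sym (lookup∘tabulate _ i)) ([]=⇒lookup i∈)))

answer-below-yes : ∀ {n x} {E : Subset n} → answer (below x) E ≡ true → ∃[ i ] i ∈ E × toℕ i < x
answer-below-yes {x = x} {E} said-yes =
  let i , i∈ = answer≡true⇒Nonempty (below x) E said-yes
      i∈below , i∈E = x∈p∩q⁻ (below x) E i∈
  in i , i∈E , ∈-below⁻ i∈below

answer-below-no : ∀ {n x} {E : Subset n} {i} → answer (below x) E ≡ false → i ∈ E → x ≤ toℕ i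
answer-below-no {x = x} {E} {i} said-no i∈E = ≮⇒≥ λ i<x →
  let said-yes = Nonempty⇒answer≡true (below x) E (i , x∈p∩q⁺ (∈-below⁺ i<x , i∈E))
  in contradiction (trans (sym said-yes) said-no) λ ()

-- While every answer so far was no, lo + w = (m+1)^r > n and found is vacuous; so the search
-- needs no flag recording whether some element is known to be excellent.
record Located {n} (E : Subset n) (lo w : ℕ) : Set where
  field
    above : ∀ {i} → i ∈ E → lo ≤ toℕ i
    found : lo + w ≤ n → ∃[ i ] i ∈ E × toℕ i < lo + w

open Located

thresholds : ∀ {n} m → ℕ → ℕ → Vec (Subset n) m
thresholds zero    lo w = []
thresholds (suc m) lo w = below (lo + w) ∷ thresholds m (lo + w) w

advance : ∀ {m} → Vec Bool m → ℕ → ℕ → ℕ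
advance []           lo w = lo
advance (true  ∷ _)  lo w = lo
advance (false ∷ as) lo w = advance as (lo + w) w

located-advance : ∀ {n} {E : Subset n} m lo w → Located E lo (suc m * w) →
                  Located E (advance (map (λ A → answer A E) (thresholds m lo w)) lo w) w
located-advance {E = E} zero lo w loc = subst (Located E lo) (+-identityʳ w) loc
located-advance {n} {E} (suc m) lo w loc with answer (below (lo + w)) E in eq
... | true  = record { above = above loc ; found = λ _ → answer-below-yes eq }
... | false = located-advance m (lo + w) w record
  { above = answer-below-no eq
  ; found = subst (λ z → z ≤ n → ∃[ i ] i ∈ E × toℕ i < z) (sym (+-assoc lo w (suc m * w))) (found loc)
  }

guess : ∀ {n} → ℕ → Output n
guess {n} lo with lo <? n
... | yes lo<n = name (fromℕ< lo<n)
... | no  _    = noneEx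

guess-correct : ∀ {n} {E : Subset n} {lo} → Located E lo 1 → CorrectFor E (guess lo)
guess-correct {n} {E} {lo} loc with lo <? n
... | yes lo<n =
  let i , i∈E , i<lo+1 = found loc (subst (_≤ n) (+-comm 1 lo) lo<n)
      i≡lo = ≤-antisym (m<1+n⇒m≤n (subst (toℕ i <_) (+-comm lo 1) i<lo+1)) (above loc i∈E)
  in subst (λ j → lookup E j ≡ true) (toℕ-injective (trans i≡lo (sym (toℕ-fromℕ< lo<n)))) ([]=⇒lookup i∈E)
... | no lo≮n = λ i → ¬-not λ i∈E → lo≮n (≤-<-trans (above loc (lookup⇒[]= i E i∈E)) (toℕ<n i))

search : ∀ {n} m j → ℕ → Strategy n j
search m zero    lo = finish (guess lo)
search m (suc j) lo = round m (thresholds m lo (suc m ^ j)) λ as → search m j (advance as lo (suc m ^ j))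

search-correct : ∀ {n} {E : Subset n} m j lo →
                 Located E lo (suc m ^ j) → CorrectFor E (output (search m j lo) E)
search-correct m zero    lo loc = guess-correct loc
search-correct m (suc j) lo loc = search-correct m j _ (located-advance m lo (suc m ^ j) loc)

search-cost : ∀ {n} m j lo (E : Subset n) → cost (search m j lo) E ≡ j * m
search-cost m zero    lo E = refl
search-cost m (suc j) lo E = cong (m +_) (search-cost m j _ E)

search-achieves : ∀ {n r} m → n < suc m ^ r → Achievable n r (r * m)
search-achieves {n} {r} m n<[1+m]ʳ =
  search m r 0 , (λ E → search-correct m r 0 (start E)) , (λ E → ≤-reflexive (search-cost m r 0 E))
  where
  start : ∀ E → Located E 0 (suc m ^ r)
  start E = record { above = λ _ → z≤n ; found = λ [1+m]ʳ≤n → contradiction [1+m]ʳ≤n (<⇒≱ n<[1+m]ʳ) }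

upper-bound : ∀ {r} n → 1 ≤ r → Σ[ q ∈ ℕ ] (Achievable n r q × q ^ r ≤ r ^ r * n)
upper-bound {r} n r≥1 =
  let m , mʳ≤n , n<[1+m]ʳ = nth-root r≥1 n
  in r * m , search-achieves m n<[1+m]ʳ , (begin
    (r * m) ^ r   ≡⟨ ^-distribʳ-* r m r ⟩
    r ^ r * m ^ r ≤⟨ *-monoʳ-≤ (r ^ r) mʳ≤n ⟩
    r ^ r * n     ∎)
  where open ≤-Reasoning

theorem1p1 : ∀ (r n : ℕ) → 1 ≤ r → 1 ≤ n →
    (Σ[ q ∈ ℕ ] (Achievable n r q × q ^ r ≤ r ^ r * n))
    × (∀ (q : ℕ) → Achievable n r q → r ^ r * n ≤ (q + 2 * r ∸ 1) ^ r)
theorem1p1 r n r≥1 _ = upper-bound n r≥1 , λ q → lower-bound r≥1
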